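{- Let $n\geq 2$ and let $G$ be an $n$-connected graph of girth at least $n$. Let $T$ be a set of $n-1$ edges of $G$ incident to a vertex $v$ of degree at least $2n-2$. Then the $n$-point splitting graph $G'_T$ is $n$-connected.
   Context: $n$-point splitting: let $G$ be a graph with a vertex $v$ of degree at least $2n-2$ and let $T=\{vv_1,\dots,vv_{n-1}\}$ be a set of $n-1$ edges incident to $v$. The graph $G'_T$ is obtained from $G$ by replacing $v$ by two new adjacent vertices $u$ and $w$, where $u$ is made adjacent to $v_1,\dots,v_{n-1}$ and $w$ is made adjacent to all vertices that were adjacent to $v$ via edges other than those in $T$. -}

module Defs where

open import Data.Nat using (ℕ; zero; suc; _+_; _*_; _∸_; _≤_; _<_)
open import Data.Bool using (Bool; true; false; if_then_else_; _∧_; not)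
open import Data.Fin using (Fin; zero; suc; inject₁; fromℕ; _≟_)
open import Data.Fin.Subset using (Subset; _∉_; ∣_∣)
open import Data.Vec using (tabulate; lookup)
open import Data.Product using (_×_)
open import Relation.Nullary using (does)
open import Relation.Binary.PropositionalEquality using (_≡_)
open import Function.Definitions using (Injective)

Adjacency : ℕ → Set
Adjacency m = Fin m → Fin m → Bool

record SimpleGraph (m : ℕ) : Set where
  field
    adj     : Adjacency m
    sym     : ∀ x y → adj x y ≡ adj y x
    irrefl  : ∀ x → adj x x ≡ false
open SimpleGraph public

nbhd : ∀ {m} → Adjacency m → Fin m → Subset m
nbhd a v = tabulate (a v)

degree : ∀ {m} → Adjacency m → Fin m → ℕ
degree a v = ∣ nbhd a v ∣

-- Walks x = x₀, x₁, …, x_k = y in the graph minus the vertex set S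
-- (every vertex after the start avoids S; the start is required to avoid S separately).
data WalkAvoiding {m : ℕ} (a : Adjacency m) (S : Subset m) : Fin m → Fin m → Set where
  here : ∀ {x} → WalkAvoiding a S x x
  step : ∀ {x y z} → a x y ≡ true → y ∉ S → WalkAvoiding a S y z → WalkAvoiding a S x z

ConnectedAvoiding : ∀ {m} → Adjacency m → Subset m → Set
ConnectedAvoiding {m} a S = ∀ (x y : Fin m) → x ∉ S → y ∉ S → WalkAvoiding a S x y

IsKConnected : ∀ {m} → ℕ → Adjacency m → Set
IsKConnected {m} k a = (suc k ≤ m) × (∀ (S : Subset m) → ∣ S ∣ < k → ConnectedAvoiding a S)

record Cycle {m : ℕ} (a : Adjacency m) (j : ℕ) : Set where
  field
    c        : Fin (suc j) → Fin m
    long     : 3 ≤ suc j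
    distinct : Injective _≡_ _≡_ c
    consec   : ∀ (i : Fin j) → a (c (inject₁ i)) (c (suc i)) ≡ true
    closing  : a (c (fromℕ j)) (c zero) ≡ true

GirthAtLeast : ∀ {m} → ℕ → Adjacency m → Set
GirthAtLeast {m} k a = ∀ (j : ℕ) → Cycle a j → k ≤ suc j

_==_ : ∀ {m} → Fin m → Fin m → Bool
x == y = does (x ≟ y)

-- The splitting graph G'_T on vertex set Fin (suc m):
--   vertex zero     = u (adjacent to w and to the vertices of T),
--   vertex suc v    = w (adjacent to u and to the neighbours of v not in T),
--   vertex suc x    = x for x ≠ v (old vertex, old adjacencies among old vertices).
-- T is given as the set of endpoints v₁,…,v_{n-1} of the edges vv₁,…,vv_{n-1}.
splitAdj : ∀ {m} → Adjacency m → Fin m → Subset m → Adjacency (suc m)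
splitAdj a v T zero    zero    = false
splitAdj a v T zero    (suc y) = if y == v then true else lookup T y
splitAdj a v T (suc x) zero    = if x == v then true else lookup T x
splitAdj a v T (suc x) (suc y) =
  if x == v
  then (if y == v then false else (a v y ∧ not (lookup T y)))
  else (if y == v then (a x v ∧ not (lookup T x)) else a x y)

module Submission where

-- Write u (vertex zero) and w (vertex suc v) for the two halves of v in
-- G' = G'_T, and suc x for every other old vertex x.  Let S be a set of fewer than n
-- vertices of G'.  We "project" S to a set S_G of vertices of G with |S_G| ≤ |S|:
--   * if u ∉ S, take S_G = S ∩ old vertices (w counting as v);
--   * if u ∈ S, take S_G = (S ∩ old vertices) ∪ {v}.
-- Then G − S_G is connected because G is n-connected, and connectivity transfers to
-- G' − S along a "shadow" (defined below): every edge of G − S_G lifts to a walk in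
-- G' − S (through u when u survives; verbatim when v ∈ S_G), and every surviving vertex
-- of G' reaches a lifted vertex.  The latter is clear except for one vertex:
--   * u when w ∈ S: some endpoint of T avoids S, as |T| = n − 1 > |S ∖ {w}|;
--   * w when u ∈ S: some neighbour of v avoids T ∪ S, as deg v ≥ 2n − 2 > (n − 1) + (n − 2).

open import Defs
open import Data.Nat using (ℕ; _*_; _∸_; _≤_)
open import Data.Fin using (Fin)
open import Data.Fin.Subset using (Subset; _⊆_; ∣_∣)
open import Relation.Binary.PropositionalEquality using (_≡_)

open import Data.Nat using (zero; suc; _+_; _<_; z≤n; s≤s)
open import Data.Nat.Properties
  using (≤-reflexive; ≤-trans; ≤-<-trans; <-≤-trans; m≤n⇒m≤1+n; +-suc; +-comm; +-identityʳ; +-monoʳ-≤; +-monoʳ-<)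
open import Data.Fin using (zero; suc; _≟_)
open import Data.Fin.Subset using (_∈_; _∉_; _∪_; _-_; ⁅_⁆)
open import Data.Fin.Subset.Properties
  using (_∈?_; drop-there; ∣p∣≤∣x∷p∣; x∈p⇒∣p-x∣<∣p∣; x∈p∧x∉q⇒x∈p─q; x≢y⇒x∉⁅y⁆; x∈⁅x⁆;
         ∣⁅x⁆∣≡1; p⊆p∪q; q⊆p∪q; x∈p∪q⁻)
open import Data.Vec using ([]; _∷_; here; there; lookup)
open import Data.Vec.Properties using ([]=⇒lookup; lookup⇒[]=; lookup∘tabulate)
open import Data.Bool using (true; false; not; _∧_)
open import Data.Product using (Σ-syntax; ∃; _×_; _,_; proj₁; proj₂)
open import Data.Sum using (_⊎_; inj₁; inj₂; [_,_])
open import Data.Empty using (⊥; ⊥-elim)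
open import Relation.Nullary using (Dec; yes; no)
open import Relation.Nullary.Decidable using (dec-true; dec-false)
open import Relation.Binary.PropositionalEquality using (_≢_; refl; trans; cong)
import Relation.Binary.PropositionalEquality as ≡

larger⇒new-element : ∀ {k} (p q : Subset k) → ∣ q ∣ < ∣ p ∣ → ∃ λ t → t ∈ p × t ∉ q
larger⇒new-element [] [] ()
larger⇒new-element (true ∷ p) (false ∷ q) _ = zero , here , λ ()
larger⇒new-element (true ∷ p) (true ∷ q) (s≤s q<p) with larger⇒new-element p q q<p
... | t , t∈p , t∉q = suc t , there t∈p , λ t∈q → t∉q (drop-there t∈q)
larger⇒new-element (false ∷ p) (b ∷ q) q<p
  with larger⇒new-element p q (≤-<-trans (∣p∣≤∣x∷p∣ b q) q<p)
... | t , t∈p , t∉q = suc t , there t∈p , λ t∈q → t∉q (drop-there t∈q)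

∣p∪q∣≤∣p∣+∣q∣ : ∀ {k} (p q : Subset k) → ∣ p ∪ q ∣ ≤ ∣ p ∣ + ∣ q ∣
∣p∪q∣≤∣p∣+∣q∣ [] [] = z≤n
∣p∪q∣≤∣p∣+∣q∣ (true ∷ p) (b ∷ q) =
  s≤s (≤-trans (∣p∪q∣≤∣p∣+∣q∣ p q) (+-monoʳ-≤ ∣ p ∣ (∣p∣≤∣x∷p∣ b q)))
∣p∪q∣≤∣p∣+∣q∣ (false ∷ p) (true ∷ q) rewrite +-suc ∣ p ∣ ∣ q ∣ = s≤s (∣p∪q∣≤∣p∣+∣q∣ p q)
∣p∪q∣≤∣p∣+∣q∣ (false ∷ p) (false ∷ q) = ∣p∪q∣≤∣p∣+∣q∣ p q

∉-∪ : ∀ {k} {x : Fin k} {p q : Subset k} → x ∉ p → x ∉ q → x ∉ p ∪ q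
∉-∪ {p = p} {q} x∉p x∉q x∈p∪q = [ x∉p , x∉q ] (x∈p∪q⁻ p q x∈p∪q)

∉⇒lookup≡false : ∀ {k} {t : Fin k} (p : Subset k) → t ∉ p → lookup p t ≡ false
∉⇒lookup≡false {t = t} p t∉p with lookup p t in eq
... | true  = ⊥-elim (t∉p (lookup⇒[]= t p eq))
... | false = refl

==-refl : ∀ {k} (x : Fin k) → (x == x) ≡ true
==-refl x = dec-true (x ≟ x) refl

==-≢ : ∀ {k} {x y : Fin k} → x ≢ y → (x == y) ≡ false
==-≢ {x = x} {y} = dec-false (x ≟ y)

_++ʷ_ : ∀ {m} {a : Adjacency m} {S : Subset m} {x y z} →
        WalkAvoiding a S x y → WalkAvoiding a S y z → WalkAvoiding a S x z
here        ++ʷ q = q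
step e y∉ p ++ʷ q = step e y∉ (p ++ʷ q)

-- In a symmetric graph a walk can be reversed, provided its start avoids S
-- (the start becomes the end, and every non-initial vertex must avoid S).
reverseʷ : ∀ {m} {a : Adjacency m} {S : Subset m} → (∀ x y → a x y ≡ a y x) →
           ∀ {x y} → x ∉ S → WalkAvoiding a S x y → WalkAvoiding a S y x
reverseʷ {a = a} {S} a-sym x∉S p = onto x∉S p here
  where
  -- onto p acc prepends the reversal of p to the walk acc.
  onto : ∀ {x y z} → x ∉ S → WalkAvoiding a S x y → WalkAvoiding a S x z → WalkAvoiding a S y z
  onto x∉S here acc = acc
  onto {x} x∉S (step {y = y} e y∉S p) acc = onto y∉S p (step (trans (a-sym y x) e) x∉S acc)

mapʷ : ∀ {m m'} {a : Adjacency m} {a' : Adjacency m'} {SG : Subset m} {S : Subset m'}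
       (f : Fin m → Fin m') →
       (∀ {x y} → x ∉ SG → y ∉ SG → a x y ≡ true → WalkAvoiding a' S (f x) (f y)) →
       ∀ {x y} → x ∉ SG → WalkAvoiding a SG x y → WalkAvoiding a' S (f x) (f y)
mapʷ f lift x∉ here          = here
mapʷ f lift x∉ (step e y∉ p) = lift x∉ y∉ e ++ʷ mapʷ f lift y∉ p

record Shadow {m m'} (a : Adjacency m) (a' : Adjacency m') (f : Fin m → Fin m')
              (SG : Subset m) (S : Subset m') : Set where
  field
    lifts   : ∀ {x y} → x ∉ SG → y ∉ SG → a x y ≡ true → WalkAvoiding a' S (f x) (f y)
    reaches : ∀ {x'} → x' ∉ S → ∃ λ z → z ∉ SG × WalkAvoiding a' S x' (f z)

shadow-connected : ∀ {m m'} {a : Adjacency m} {a' : Adjacency m'} {f : Fin m → Fin m'}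
                   {SG : Subset m} {S : Subset m'} →
                   (∀ x y → a' x y ≡ a' y x) → Shadow a a' f SG S →
                   ConnectedAvoiding a SG → ConnectedAvoiding a' S
shadow-connected {f = f} a'-sym shadow connected x' y' x'∉S y'∉S
  with Shadow.reaches shadow x'∉S | Shadow.reaches shadow y'∉S
... | z₁ , z₁∉ , x'→z₁ | z₂ , z₂∉ , y'→z₂ =
  x'→z₁ ++ʷ (mapʷ f (Shadow.lifts shadow) z₁∉ (connected z₁ z₂ z₁∉ z₂∉) ++ʷ reverseʷ a'-sym y'∉S y'→z₂)

-- Used when w ∈ S: |S ∖ {w}| < |S| < n gives |S ∖ {w}| < n − 1.
<-below-pred : ∀ {a b n} → a < b → b < n → a < n ∸ 1
<-below-pred a<b (s≤s b≤n-1) = <-≤-trans a<b b≤n-1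

double∸2 : ∀ k → 2 * suc k ∸ 2 ≡ k + k
double∸2 k rewrite +-identityʳ k | +-suc k k = refl

-- Used when u ∈ S: (n − 1) + (|S| − 1) < 2n − 2.
pred+<double∸2 : ∀ {n s} → suc s < n → n ∸ 1 + s < 2 * n ∸ 2
pred+<double∸2 {suc k} {s} (s≤s s<k) rewrite double∸2 k = +-monoʳ-< k s<k

module Splitting {m : ℕ} (G : SimpleGraph m) (v : Fin m) (T : Subset m) where

  private
    a : Adjacency m
    a = adj G

  G' : Adjacency (suc m)
  G' = splitAdj a v T

  no-loop : ∀ {x} → a x x ≡ true → ⊥
  no-loop {x} e with trans (≡.sym e) (irrefl G x)
  ... | ()

  nbhd⇒adjacent : ∀ {t} → t ∈ nbhd a v → a v t ≡ true
  nbhd⇒adjacent {t} t∈N = trans (≡.sym (lookup∘tabulate (a v) t)) ([]=⇒lookup t∈N)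

  adjacent⇒≢ : ∀ {t} → a v t ≡ true → t ≢ v
  adjacent⇒≢ e refl = no-loop e

  split-sym : ∀ x y → G' x y ≡ G' y x
  split-sym zero    zero    = refl
  split-sym zero    (suc y) = refl
  split-sym (suc x) zero    = refl
  split-sym (suc x) (suc y) with x ≟ v | y ≟ v
  ... | yes refl | yes refl = refl
  ... | yes refl | no _    = cong (_∧ not (lookup T y)) (sym G x y)
  ... | no _    | yes refl = cong (_∧ not (lookup T x)) (sym G x y)
  ... | no _    | no _     = sym G x y

  u~w : G' zero (suc v) ≡ true
  u~w rewrite ==-refl v = refl

  u~T : ∀ {t} → t ≢ v → t ∈ T → G' zero (suc t) ≡ true
  u~T t≢v t∈T rewrite ==-≢ t≢v = []=⇒lookup t∈T

  w~N∖T : ∀ {t} → t ≢ v → a v t ≡ true → t ∉ T → G' (suc v) (suc t) ≡ true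
  w~N∖T t≢v v~t t∉T rewrite ==-refl v | ==-≢ t≢v | v~t | ∉⇒lookup≡false T t∉T = refl

  old~old : ∀ {x y} → x ≢ v → y ≢ v → G' (suc x) (suc y) ≡ a x y
  old~old x≢v y≢v rewrite ==-≢ x≢v | ==-≢ y≢v = refl

  edge-split : ∀ {x y} → a x y ≡ true →
               G' (suc x) (suc y) ≡ true ⊎ (G' (suc x) zero ≡ true × G' zero (suc y) ≡ true)
  edge-split {x} {y} e = by-cases (x ≟ v) (y ≟ v)
    where
    by-cases : Dec (x ≡ v) → Dec (y ≡ v) →
               G' (suc x) (suc y) ≡ true ⊎ (G' (suc x) zero ≡ true × G' zero (suc y) ≡ true)
    by-cases (yes refl) (yes refl) = ⊥-elim (no-loop e)
    by-cases (yes refl) (no y≢v) with y ∈? T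
    ... | yes y∈T = inj₂ (trans (split-sym (suc v) zero) u~w , u~T y≢v y∈T)
    ... | no  y∉T = inj₁ (w~N∖T y≢v e y∉T)
    by-cases (no x≢v) (yes refl) with x ∈? T
    ... | yes x∈T = inj₂ (trans (split-sym (suc x) zero) (u~T x≢v x∈T) , u~w)
    ... | no  x∉T = inj₁ (trans (split-sym (suc x) (suc v)) (w~N∖T x≢v (trans (sym G v x) e) x∉T))
    by-cases (no x≢v) (no y≢v) = inj₁ (trans (old~old x≢v y≢v) e)

  lifts-through-u : ∀ {SG : Subset m} {S : Subset (suc m)} → zero ∉ S →
                    (∀ {z} → z ∉ SG → suc z ∉ S) →
                    ∀ {x y} → x ∉ SG → y ∉ SG → a x y ≡ true → WalkAvoiding G' S (suc x) (suc y)
  lifts-through-u u∉S avoids _ y∉SG e with edge-split e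
  ... | inj₁ x~y        = step x~y (avoids y∉SG) here
  ... | inj₂ (x~u , u~y) = step x~u u∉S (step u~y (avoids y∉SG) here)

  lifts-without-v : ∀ {SG : Subset m} {S : Subset (suc m)} → v ∈ SG →
                    (∀ {z} → z ∉ SG → suc z ∉ S) →
                    ∀ {x y} → x ∉ SG → y ∉ SG → a x y ≡ true → WalkAvoiding G' S (suc x) (suc y)
  lifts-without-v {SG} v∈SG avoids x∉SG y∉SG e =
    step (trans (old~old (≢v x∉SG) (≢v y∉SG)) e) (avoids y∉SG) here
    where
    ≢v : ∀ {z} → z ∉ SG → z ≢ v
    ≢v z∉SG refl = z∉SG v∈SG

  reaches-itself : ∀ {b} {S₀ : Subset m} {x} → suc x ∉ b ∷ S₀ →
                   ∃ λ z → z ∉ S₀ × WalkAvoiding G' (b ∷ S₀) (suc x) (suc z)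
  reaches-itself {x = x} x∉S = x , (λ x∈S₀ → x∉S (there x∈S₀)) , here

  avoids-tail : ∀ {b} {S₀ : Subset m} {z} → z ∉ S₀ → suc z ∉ b ∷ S₀
  avoids-tail z∉S₀ z∈S = z∉S₀ (drop-there z∈S)

  Projection : Subset (suc m) → Set
  Projection S = Σ[ SG ∈ Subset m ] ∣ SG ∣ ≤ ∣ S ∣ × Shadow a G' suc SG S

  project-keeping-u-w : ∀ {S₀} → v ∉ S₀ → Projection (false ∷ S₀)
  project-keeping-u-w {S₀} v∉S₀ = S₀ , ∣p∣≤∣x∷p∣ false S₀ , record
    { lifts   = lifts-through-u (λ ()) avoids-tail
    ; reaches = λ { {zero} _ → v , v∉S₀ , step u~w (avoids-tail v∉S₀) here
                  ; {suc x} x∉S → reaches-itself x∉S } }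

  project-deleting-w : ∀ {n S₀} → v ∈ S₀ → ∣ false ∷ S₀ ∣ < n →
                       T ⊆ nbhd a v → ∣ T ∣ ≡ n ∸ 1 → Projection (false ∷ S₀)
  project-deleting-w {n} {S₀} v∈S₀ ∣S∣<n T⊆N ∣T∣≡n-1 = S₀ , ∣p∣≤∣x∷p∣ false S₀ , record
    { lifts   = lifts-through-u (λ ()) avoids-tail
    ; reaches = λ { {zero} _ → t , t∉S₀ , step (u~T t≢v t∈T) (avoids-tail t∉S₀) here
                  ; {suc x} x∉S → reaches-itself x∉S } }
    where
    S₀∖v<T : ∣ S₀ - v ∣ < ∣ T ∣
    S₀∖v<T rewrite ∣T∣≡n-1 = <-below-pred (x∈p⇒∣p-x∣<∣p∣ v∈S₀) ∣S∣<n
    fresh : ∃ λ t → t ∈ T × t ∉ S₀ - v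
    fresh = larger⇒new-element T (S₀ - v) S₀∖v<T
    t = proj₁ fresh
    t∈T : t ∈ T
    t∈T = proj₁ (proj₂ fresh)
    t≢v : t ≢ v
    t≢v = adjacent⇒≢ (nbhd⇒adjacent (T⊆N t∈T))
    t∉S₀ : t ∉ S₀
    t∉S₀ t∈S₀ = proj₂ (proj₂ fresh) (x∈p∧x∉q⇒x∈p─q t∈S₀ (x≢y⇒x∉⁅y⁆ t≢v))

  project-deleting-u-w : ∀ {S₀} → v ∈ S₀ → Projection (true ∷ S₀)
  project-deleting-u-w {S₀} v∈S₀ = S₀ , ∣p∣≤∣x∷p∣ true S₀ , record
    { lifts   = lifts-without-v v∈S₀ avoids-tail
    ; reaches = λ { {zero} u∉S → ⊥-elim (u∉S here)
                  ; {suc x} x∉S → reaches-itself x∉S } }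

  project-deleting-u : ∀ {n S₀} → v ∉ S₀ → ∣ true ∷ S₀ ∣ < n →
                       2 * n ∸ 2 ≤ degree a v → ∣ T ∣ ≡ n ∸ 1 → Projection (true ∷ S₀)
  project-deleting-u {n} {S₀} v∉S₀ ∣S∣<n deg ∣T∣≡n-1 = SG , ∣SG∣≤∣S∣ , record
    { lifts   = lifts-without-v v∈SG λ z∉SG → avoids-tail (λ z∈S₀ → z∉SG (p⊆p∪q ⁅ v ⁆ z∈S₀))
    ; reaches = λ { {zero} u∉S → ⊥-elim (u∉S here)
                  ; {suc x} x∉S → reach x∉S } }
    where
    SG : Subset m
    SG = S₀ ∪ ⁅ v ⁆
    v∈SG : v ∈ SG
    v∈SG = q⊆p∪q S₀ ⁅ v ⁆ (x∈⁅x⁆ v)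
    ∣SG∣≤∣S∣ : ∣ SG ∣ ≤ ∣ true ∷ S₀ ∣
    ∣SG∣≤∣S∣ = ≤-trans (∣p∪q∣≤∣p∣+∣q∣ S₀ ⁅ v ⁆)
                       (≤-reflexive (trans (cong (∣ S₀ ∣ +_) (∣⁅x⁆∣≡1 v)) (+-comm ∣ S₀ ∣ 1)))
    T∪S₀<N : ∣ T ∪ S₀ ∣ < ∣ nbhd a v ∣
    T∪S₀<N = <-≤-trans (≤-<-trans (∣p∪q∣≤∣p∣+∣q∣ T S₀)
                                  (≤-<-trans (≤-reflexive (cong (_+ ∣ S₀ ∣) ∣T∣≡n-1))
                                             (pred+<double∸2 ∣S∣<n)))
                       deg
    fresh : ∃ λ t → t ∈ nbhd a v × t ∉ T ∪ S₀
    fresh = larger⇒new-element (nbhd a v) (T ∪ S₀) T∪S₀<N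
    t = proj₁ fresh
    v~t : a v t ≡ true
    v~t = nbhd⇒adjacent (proj₁ (proj₂ fresh))
    t≢v : t ≢ v
    t≢v = adjacent⇒≢ v~t
    t∉T : t ∉ T
    t∉T t∈T = proj₂ (proj₂ fresh) (p⊆p∪q S₀ t∈T)
    t∉S₀ : t ∉ S₀
    t∉S₀ t∈S₀ = proj₂ (proj₂ fresh) (q⊆p∪q T S₀ t∈S₀)
    reach : ∀ {x} → suc x ∉ true ∷ S₀ → ∃ λ z → z ∉ SG × WalkAvoiding G' (true ∷ S₀) (suc x) (suc z)
    reach {x} x∉S with x ≟ v
    ... | yes refl = t , ∉-∪ t∉S₀ (x≢y⇒x∉⁅y⁆ t≢v) , step (w~N∖T t≢v v~t t∉T) (avoids-tail t∉S₀) here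
    ... | no x≢v  = x , ∉-∪ (λ x∈S₀ → x∉S (there x∈S₀)) (x≢y⇒x∉⁅y⁆ x≢v) , here

  project : ∀ {n} (S : Subset (suc m)) → ∣ S ∣ < n →
            T ⊆ nbhd a v → ∣ T ∣ ≡ n ∸ 1 → 2 * n ∸ 2 ≤ degree a v → Projection S
  project (false ∷ S₀) ∣S∣<n T⊆N ∣T∣≡n-1 deg with v ∈? S₀
  ... | no  v∉S₀ = project-keeping-u-w v∉S₀
  ... | yes v∈S₀ = project-deleting-w v∈S₀ ∣S∣<n T⊆N ∣T∣≡n-1
  project (true ∷ S₀) ∣S∣<n T⊆N ∣T∣≡n-1 deg with v ∈? S₀
  ... | no  v∉S₀ = project-deleting-u v∉S₀ ∣S∣<n deg ∣T∣≡n-1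
  ... | yes v∈S₀ = project-deleting-u-w v∈S₀

theorem4p2 : ∀ {m : ℕ} (n : ℕ) (G : SimpleGraph m) (v : Fin m) (T : Subset m) →
    2 ≤ n →
    IsKConnected n (adj G) →
    GirthAtLeast n (adj G) →
    2 * n ∸ 2 ≤ degree (adj G) v →
    T ⊆ nbhd (adj G) v →
    ∣ T ∣ ≡ n ∸ 1 →
    IsKConnected n (splitAdj (adj G) v T)
theorem4p2 n G v T _ (enough-vertices , connected) _ deg T⊆N ∣T∣≡n-1 =
  m≤n⇒m≤1+n enough-vertices , G'-S-connected
  where
  open Splitting G v T
  G'-S-connected : ∀ S → ∣ S ∣ < n → ConnectedAvoiding G' S
  G'-S-connected S ∣S∣<n =
    let (SG , ∣SG∣≤∣S∣ , shadow) = project S ∣S∣<n T⊆N ∣T∣≡n-1 deg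
    in  shadow-connected split-sym shadow (connected SG (≤-<-trans ∣SG∣≤∣S∣ ∣S∣<n))
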